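{- Let $(A,\le,0,1)$ be a bounded poset satisfying both the Ascending Chain Condition and the Descending Chain Condition, and let $x,y,z,w\in A$. Then: (1) $x\odot y=y\odot x$ and $1\odot x=x=x\odot1$; (2) $x\odot(y\odot z)=(x\odot y)\odot z$; (3) if $x\le z$ and $y\le w$ then $x\odot y\le_1 z\odot w$; (4) $x\odot y\le_1 z$ if and only if $x\le_1 y\to z$; (5) $(x\to y)\odot x\le y$.
   Context: ACC: no infinite strictly ascending chains; DCC: no infinite strictly descending chains. For $X\subseteq A$: $L(X)$, $U(X)$ the sets of lower/upper bounds, $\operatorname{Max}X$ the set of maximal elements. A singleton $\{a\}$ is identified with $a$. For subsets $X,Y$: $X\le Y$ iff $x\le y$ for all $x\in X,y\in Y$; $X\le_1Y$ iff every $x\in X$ lies below some $y\in Y$. Operators: $x\odot y=\operatorname{Max}L(\{x,y\})$ (a subset of $A$); $x\to y=\operatorname{Max}\{z\in A\mid x\odot z\le y\}$; for nonempty $B,C\subseteq A$, $B\odot C=\operatorname{Max}\{a\in A\mid a\le U(\bigcup\{b\odot c\mid b\in B,c\in C\})\}$. Expressions combining an element with a set, such as $x\odot(y\odot z)$ or $(x\to y)\odot x$, are computed with this last formula, the element being regarded as a singleton. -}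

module Defs where

open import Level using (Level; _⊔_; Lift)
open import Data.Nat using (ℕ; suc)
open import Data.Product using (Σ; ∃; _×_)
open import Data.Sum using (_⊎_)
open import Relation.Nullary using (¬_)
open import Relation.Unary using (Pred)
open import Relation.Binary.Bundles using (Poset)
open import Relation.Binary.Definitions using (Maximum; Minimum)

module PosetOps {c ℓ₁ ℓ₂ : Level} (P : Poset c ℓ₁ ℓ₂) where
  open Poset P renaming (Carrier to A)

  ℓS : Level
  ℓS = c ⊔ ℓ₁ ⊔ ℓ₂

  Sub : Set (Level.suc ℓS)
  Sub = Pred A ℓS

  _<_ : A → A → Set (ℓ₁ ⊔ ℓ₂)
  a < b = (a ≤ b) × ¬ (a ≈ b)

  IsBounded : A → A → Set (c ⊔ ℓ₂)
  IsBounded bot top = Minimum _≤_ bot × Maximum _≤_ top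

  ACC : Set (c ⊔ ℓ₁ ⊔ ℓ₂)
  ACC = ¬ (Σ (ℕ → A) λ f → ∀ n → f n < f (suc n))

  DCC : Set (c ⊔ ℓ₁ ⊔ ℓ₂)
  DCC = ¬ (Σ (ℕ → A) λ f → ∀ n → f (suc n) < f n)

  -- singleton {a} (an element is identified with its singleton)
  ⟦_⟧ : A → Sub
  ⟦ a ⟧ b = Lift ℓS (b ≈ a)

  ⟦_,_⟧ : A → A → Sub
  ⟦ x , y ⟧ b = Lift ℓS ((b ≈ x) ⊎ (b ≈ y))

  L : Sub → Sub
  L X a = ∀ x → X x → a ≤ x

  U : Sub → Sub
  U X a = ∀ x → X x → x ≤ a

  Max : Sub → Sub
  Max X a = X a × (∀ b → X b → a ≤ b → a ≈ b)

  _≤ˢ_ : Sub → Sub → Set ℓS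
  X ≤ˢ Y = ∀ x y → X x → Y y → x ≤ y

  _≤₁_ : Sub → Sub → Set ℓS
  X ≤₁ Y = ∀ x → X x → ∃ λ y → Y y × x ≤ y

  infix 4 _≤ˢ_ _≤₁_
  infixl 7 _⊙_ _⊙ˢ_
  infixr 6 _⇒_

  _⊙_ : A → A → Sub
  x ⊙ y = Max (L ⟦ x , y ⟧)

  _⇒_ : A → A → Sub
  x ⇒ y = Max (λ z → x ⊙ z ≤ˢ ⟦ y ⟧)

  ⋃⊙ : Sub → Sub → Sub
  ⋃⊙ B C a = ∃ λ b → ∃ λ c → B b × C c × (b ⊙ c) a

  _⊙ˢ_ : Sub → Sub → Sub
  B ⊙ˢ C = Max (λ a → ⟦ a ⟧ ≤ˢ U (⋃⊙ B C))

{-# OPTIONS --safe #-}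
-- Parts (2)-(4) rest on one consequence of ACC under excluded middle: every element of a
-- subset lies below a maximal element of it (otherwise one climbs a strictly ascending
-- chain).  So a common lower bound of x and y lies below some element of x ⊙ y, and hence an
-- element lies below a member of ⋃{x ⊙ c | c ∈ y ⊙ z}, or of ⋃{b ⊙ z | b ∈ x ⊙ y}, exactly
-- when it is a lower bound of {x, y, z}.  The two unions thus have the same upper bounds,
-- which is all that ⊙ on sets depends on.
module Submission where

open import Defs
open import Level using (Level; _⊔_; Lift; lift; lower)
open import Data.Nat using (ℕ; zero; suc)
open import Data.Product using (Σ; ∃; _×_; _,_; proj₁; proj₂)
open import Data.Sum using (inj₁; inj₂)
open import Data.Empty using (⊥-elim)
open import Function.Base using (_∘_)
open import Function.Bundles using (_⇔_; mk⇔)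
open import Relation.Nullary using (¬_; yes; no)
open import Relation.Nullary.Decidable using (map′; decidable-stable)
open import Relation.Unary using (_⊆_; _≐_)
open import Relation.Unary.Properties using (≐-sym; ≐-trans)
open import Relation.Binary.Bundles using (Poset)
open import Relation.Binary.Definitions using (Maximum)
open import Axiom.ExcludedMiddle using (ExcludedMiddle)

module PosetOpsProperties {c ℓ₁ ℓ₂ : Level} (P : Poset c ℓ₁ ℓ₂) where
  open Poset P renaming (Carrier to A)
  open PosetOps P

  L-pair⁺ : ∀ {a x y} → a ≤ x → a ≤ y → L (⟦_,_⟧ x y) a
  L-pair⁺ a≤x a≤y t (lift (inj₁ t≈x)) = trans a≤x (reflexive (Eq.sym t≈x))
  L-pair⁺ a≤x a≤y t (lift (inj₂ t≈y)) = trans a≤y (reflexive (Eq.sym t≈y))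

  L-pair⁻ˡ : ∀ {a x y} → L (⟦_,_⟧ x y) a → a ≤ x
  L-pair⁻ˡ {x = x} La = La x (lift (inj₁ Eq.refl))

  L-pair⁻ʳ : ∀ {a x y} → L (⟦_,_⟧ x y) a → a ≤ y
  L-pair⁻ʳ {y = y} La = La y (lift (inj₂ Eq.refl))

  ⊙-≤ˡ : ∀ {a x y} → (x ⊙ y) a → a ≤ x
  ⊙-≤ˡ = L-pair⁻ˡ ∘ proj₁

  ⊙-≤ʳ : ∀ {a x y} → (x ⊙ y) a → a ≤ y
  ⊙-≤ʳ = L-pair⁻ʳ ∘ proj₁

  ≤ˢ-⟦⟧⁺ : ∀ {X y} → X ⊆ (_≤ y) → X ≤ˢ ⟦ y ⟧
  ≤ˢ-⟦⟧⁺ X≤y a b Xa (lift b≈y) = trans (X≤y Xa) (reflexive (Eq.sym b≈y))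

  ≤ˢ-⟦⟧⁻ : ∀ {X y} → X ≤ˢ ⟦ y ⟧ → X ⊆ (_≤ y)
  ≤ˢ-⟦⟧⁻ {y = y} X≤y {a} Xa = X≤y a y Xa (lift Eq.refl)

  ≤₁-⟦⟧⁺ : ∀ {X y} → X ⊆ (_≤ y) → X ≤₁ ⟦ y ⟧
  ≤₁-⟦⟧⁺ {y = y} X≤y a Xa = y , lift Eq.refl , X≤y Xa

  ≤₁-⟦⟧⁻ : ∀ {X y} → X ≤₁ ⟦ y ⟧ → X ⊆ (_≤ y)
  ≤₁-⟦⟧⁻ X≤₁y {a} Xa with X≤₁y a Xa
  ... | b , lift b≈y , a≤b = trans a≤b (reflexive b≈y)

  U-antitone-≤₁ : ∀ {X Y} → X ≤₁ Y → U Y ⊆ U X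
  U-antitone-≤₁ X≤₁Y UYu x Xx with X≤₁Y x Xx
  ... | y , Yy , x≤y = trans x≤y (UYu y Yy)

  Max-cong : ∀ {X Y} → X ≐ Y → Max X ≐ Max Y
  Max-cong (X⊆Y , Y⊆X) = restrict (X⊆Y , Y⊆X) , restrict (Y⊆X , X⊆Y)
    where
    restrict : ∀ {X Y} → X ≐ Y → Max X ⊆ Max Y
    restrict (X⊆Y , Y⊆X) (Xa , maximal) = X⊆Y Xa , λ b Yb a≤b → maximal b (Y⊆X Yb) a≤b

  ⊙-comm : ∀ {x y} → x ⊙ y ≐ y ⊙ x
  ⊙-comm = Max-cong (swap , swap)
    where
    swap : ∀ {x y} → L (⟦_,_⟧ x y) ⊆ L (⟦_,_⟧ y x)
    swap La = L-pair⁺ (L-pair⁻ʳ La) (L-pair⁻ˡ La)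

  ⊙-congʳ : ∀ {x y y′} → y ≈ y′ → x ⊙ y ⊆ x ⊙ y′
  ⊙-congʳ y≈y′ = proj₁ (Max-cong (replace y≈y′ , replace (Eq.sym y≈y′)))
    where
    replace : ∀ {x y y′} → y ≈ y′ → L (⟦_,_⟧ x y) ⊆ L (⟦_,_⟧ x y′)
    replace y≈y′ La = L-pair⁺ (L-pair⁻ˡ La) (trans (L-pair⁻ʳ La) (reflexive y≈y′))

  ⊙-identityˡ : ∀ {𝟙} → Maximum _≤_ 𝟙 → ∀ x → 𝟙 ⊙ x ≐ ⟦ x ⟧
  ⊙-identityˡ {𝟙} top x = ⊆⟦x⟧ , ⟦x⟧⊆
    where
    ⊆⟦x⟧ : 𝟙 ⊙ x ⊆ ⟦ x ⟧
    ⊆⟦x⟧ (La , maximal) = lift (maximal x (L-pair⁺ (top x) refl) (L-pair⁻ʳ La))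
    ⟦x⟧⊆ : ⟦ x ⟧ ⊆ 𝟙 ⊙ x
    ⟦x⟧⊆ {a} (lift a≈x) = L-pair⁺ (top a) (reflexive a≈x)
                        , λ b Lb a≤b → antisym a≤b (trans (L-pair⁻ʳ Lb) (reflexive (Eq.sym a≈x)))

  ⊙-identityʳ : ∀ {𝟙} → Maximum _≤_ 𝟙 → ∀ x → ⟦ x ⟧ ≐ x ⊙ 𝟙
  ⊙-identityʳ top x = ≐-sym (≐-trans ⊙-comm (⊙-identityˡ top x))

  ⊙ˢ-≤-U : ∀ {B C a u} → (B ⊙ˢ C) a → U (⋃⊙ B C) u → a ≤ u
  ⊙ˢ-≤-U (a≤U , _) Uu = a≤U _ _ (lift Eq.refl) Uu

  ⊙ˢ-cong : ∀ {B C B′ C′} → ⋃⊙ B C ≤₁ ⋃⊙ B′ C′ → ⋃⊙ B′ C′ ≤₁ ⋃⊙ B C → B ⊙ˢ C ≐ B′ ⊙ˢ C′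
  ⊙ˢ-cong ≤₁′ ≥₁′ = Max-cong (below-U ≤₁′ , below-U ≥₁′)
    where
    below-U : ∀ {X Y} → X ≤₁ Y → (λ a → ⟦ a ⟧ ≤ˢ U X) ⊆ (λ a → ⟦ a ⟧ ≤ˢ U Y)
    below-U X≤₁Y a≤UX a′ u a′≈a UYu = a≤UX a′ u a′≈a (U-antitone-≤₁ X≤₁Y UYu)

  ⇒-⊙ˢ-≤ˢ : ∀ x y → (x ⇒ y) ⊙ˢ ⟦ x ⟧ ≤ˢ ⟦ y ⟧
  ⇒-⊙ˢ-≤ˢ x y = ≤ˢ-⟦⟧⁺ λ a∈ → ⊙ˢ-≤-U a∈ y-upper
    where
    y-upper : U (⋃⊙ (x ⇒ y) ⟦ x ⟧) y
    y-upper m (t , x′ , (x⊙t≤y , _) , lift x′≈x , m∈) = ≤ˢ-⟦⟧⁻ x⊙t≤y (proj₁ ⊙-comm (⊙-congʳ x′≈x m∈))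

  ACC⇒unbounded-empty : ACC → {R : Sub} → (∀ {b} → R b → ∃ λ b′ → R b′ × b < b′) → ∀ {a} → ¬ R a
  ACC⇒unbounded-empty acc {R} climb {a} Ra = acc (proj₁ ∘ chain , ascending)
    where
    chain : ℕ → Σ A R
    chain zero = a , Ra
    chain (suc n) = let b′ , Rb′ , _ = climb (proj₂ (chain n)) in b′ , Rb′
    ascending : ∀ n → proj₁ (chain n) < proj₁ (chain (suc n))
    ascending n = proj₂ (proj₂ (climb (proj₂ (chain n))))

  module Classical (em : ExcludedMiddle ℓS) (acc : ACC) where

    ≈-stable : ∀ {a b} → ¬ ¬ a ≈ b → a ≈ b
    ≈-stable {a} {b} = decidable-stable (map′ lower lift (em {Lift (c ⊔ ℓ₂) (a ≈ b)}))

    Max-above : ∀ {S a} → S a → ∃ λ m → Max S m × a ≤ m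
    Max-above {S} {a} Sa with em {∃ λ m → Max S m × a ≤ m}
    ... | yes found = found
    ... | no none = ⊥-elim (ACC⇒unbounded-empty acc climb (Sa , refl))
      where
      climb : ∀ {b} → S b × a ≤ b → ∃ λ b′ → (S b′ × a ≤ b′) × b < b′
      climb {b} (Sb , a≤b) with em {∃ λ b′ → S b′ × b < b′}
      ... | yes (b′ , Sb′ , b<b′) = b′ , (Sb′ , trans a≤b (proj₁ b<b′)) , b<b′
      ... | no ¬bigger = ⊥-elim (none (b , (Sb , maximal) , a≤b))
        where
        maximal : ∀ b′ → S b′ → b ≤ b′ → b ≈ b′
        maximal b′ Sb′ b≤b′ = ≈-stable λ b≉b′ → ¬bigger (b′ , Sb′ , b≤b′ , b≉b′)

    ⊙-above : ∀ {a x y} → a ≤ x → a ≤ y → ∃ λ m → (x ⊙ y) m × a ≤ m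
    ⊙-above a≤x a≤y = Max-above (L-pair⁺ a≤x a≤y)

    ⋃⊙-above : ∀ {B C a b c} → B b → C c → a ≤ b → a ≤ c → ∃ λ m → ⋃⊙ B C m × a ≤ m
    ⋃⊙-above Bb Cc a≤b a≤c with ⊙-above a≤b a≤c
    ... | m , m∈ , a≤m = m , (_ , _ , Bb , Cc , m∈) , a≤m

    ⊙-mono-≤₁ : ∀ {x y z w} → x ≤ z → y ≤ w → x ⊙ y ≤₁ z ⊙ w
    ⊙-mono-≤₁ x≤z y≤w a a∈ = ⊙-above (trans (⊙-≤ˡ a∈) x≤z) (trans (⊙-≤ʳ a∈) y≤w)

    ⋃⊙-assoc-≤₁ : ∀ x y z → ⋃⊙ ⟦ x ⟧ (y ⊙ z) ≤₁ ⋃⊙ (x ⊙ y) ⟦ z ⟧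
    ⋃⊙-assoc-≤₁ x y z m (x′ , t , lift x′≈x , t∈ , m∈) =
      let b , b∈ , m≤b = ⊙-above m≤x m≤y in ⋃⊙-above b∈ (lift Eq.refl) m≤b m≤z
      where
      m≤x : m ≤ x
      m≤x = trans (⊙-≤ˡ m∈) (reflexive x′≈x)
      m≤y : m ≤ y
      m≤y = trans (⊙-≤ʳ m∈) (⊙-≤ˡ t∈)
      m≤z : m ≤ z
      m≤z = trans (⊙-≤ʳ m∈) (⊙-≤ʳ t∈)

    ⋃⊙-assoc-≥₁ : ∀ x y z → ⋃⊙ (x ⊙ y) ⟦ z ⟧ ≤₁ ⋃⊙ ⟦ x ⟧ (y ⊙ z)
    ⋃⊙-assoc-≥₁ x y z m (t , z′ , t∈ , lift z′≈z , m∈) =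
      let b , b∈ , m≤b = ⊙-above m≤y m≤z in ⋃⊙-above (lift Eq.refl) b∈ m≤x m≤b
      where
      m≤x : m ≤ x
      m≤x = trans (⊙-≤ˡ m∈) (⊙-≤ˡ t∈)
      m≤y : m ≤ y
      m≤y = trans (⊙-≤ˡ m∈) (⊙-≤ʳ t∈)
      m≤z : m ≤ z
      m≤z = trans (⊙-≤ʳ m∈) (reflexive z′≈z)

    ⊙ˢ-assoc : ∀ x y z → ⟦ x ⟧ ⊙ˢ (y ⊙ z) ≐ (x ⊙ y) ⊙ˢ ⟦ z ⟧
    ⊙ˢ-assoc x y z = ⊙ˢ-cong (⋃⊙-assoc-≤₁ x y z) (⋃⊙-assoc-≥₁ x y z)

    ⊙-residuated : ∀ x y z → x ⊙ y ≤₁ ⟦ z ⟧ ⇔ ⟦ x ⟧ ≤₁ y ⇒ z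
    ⊙-residuated x y z = mk⇔ to from
      where
      to : x ⊙ y ≤₁ ⟦ z ⟧ → ⟦ x ⟧ ≤₁ y ⇒ z
      to x⊙y≤z a (lift a≈x) =
        let t , t∈ , x≤t = Max-above {S = λ t → y ⊙ t ≤ˢ ⟦ z ⟧} y⊙x≤z in t , t∈ , trans (reflexive a≈x) x≤t
        where
        y⊙x≤z : y ⊙ x ≤ˢ ⟦ z ⟧
        y⊙x≤z = ≤ˢ-⟦⟧⁺ (≤₁-⟦⟧⁻ x⊙y≤z ∘ proj₁ ⊙-comm)
      from : ⟦ x ⟧ ≤₁ y ⇒ z → x ⊙ y ≤₁ ⟦ z ⟧
      from x≤⇒ = ≤₁-⟦⟧⁺ below-z
        where
        below-z : x ⊙ y ⊆ (_≤ z)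
        below-z a∈ =
          let t , (y⊙t≤z , _) , x≤t = x≤⇒ x (lift Eq.refl)
              m , m∈ , a≤m = ⊙-above (⊙-≤ʳ a∈) (trans (⊙-≤ˡ a∈) x≤t)
          in trans a≤m (≤ˢ-⟦⟧⁻ y⊙t≤z m∈)

lemma6p2 : {c ℓ₁ ℓ₂ : Level} → ExcludedMiddle (c ⊔ ℓ₁ ⊔ ℓ₂) →
    (P : Poset c ℓ₁ ℓ₂) → let open Poset P renaming (Carrier to A) in let open PosetOps P in
    (𝟘 𝟙 : A) → IsBounded 𝟘 𝟙 → ACC → DCC → (x y z w : A) →
      ((x ⊙ y ≐ y ⊙ x) × (𝟙 ⊙ x ≐ ⟦ x ⟧) × (⟦ x ⟧ ≐ x ⊙ 𝟙))
    × (⟦ x ⟧ ⊙ˢ (y ⊙ z) ≐ (x ⊙ y) ⊙ˢ ⟦ z ⟧)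
    × (x ≤ z → y ≤ w → x ⊙ y ≤₁ z ⊙ w)
    × (x ⊙ y ≤₁ ⟦ z ⟧ ⇔ ⟦ x ⟧ ≤₁ y ⇒ z)
    × ((x ⇒ y) ⊙ˢ ⟦ x ⟧ ≤ˢ ⟦ y ⟧)
lemma6p2 em P 𝟘 𝟙 (_ , top) acc _ x y z w =
    (⊙-comm , ⊙-identityˡ top x , ⊙-identityʳ top x)
  , ⊙ˢ-assoc x y z
  , ⊙-mono-≤₁
  , ⊙-residuated x y z
  , ⇒-⊙ˢ-≤ˢ x y
  where
  open PosetOpsProperties P
  open Classical em acc
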